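{- Let $j$ be a nonnegative integer, and let $m=2^Lh+1$ be a positive integer where $L,h$ are integers with $L\ge3$ and $h$ odd. Let $\ell=\lceil\log_2(m+j)\rceil$. If $n$ is an integer such that $2\le n\le 2^{L-1}$, $\mathbf{t}_{m-n}=\mathbf{t}_{m-n+1}$, and $m+j\le\left(1-\frac{1}{2n+2}\right)2^\ell$, then $$\mathfrak{K}_j(m)\le 2^{\ell+1}-\frac{2^{\ell+1}(n-1)+j}{m}.$$
   Context: The Thue–Morse word $\mathbf{t}=\mathbf{t}_1\mathbf{t}_2\mathbf{t}_3\cdots=0110100110010110\cdots$ is the infinite binary word whose $i$-th letter $\mathbf{t}_i$ ($i\ge 1$) is the parity of the number of 1's in the binary expansion of $i-1$. A $k$-anti-power is a word $w^{(1)}\cdots w^{(k)}$ with $w^{(1)},\dots,w^{(k)}$ pairwise distinct words of the same length. For $j\ge0$, the $j$-fix of $\mathbf{t}$ of length $N$ is $\mathbf{t}_{j+1}\cdots\mathbf{t}_{j+N}$. For a positive integer $m$, $\mathfrak{K}_j(m)$ is the smallest positive integer $k$ such that the $j$-fix of $\mathbf{t}$ of length $km$ is not a $k$-anti-power. -}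

module Defs where

open import Data.Nat using (ℕ; zero; suc; _+_; _*_; _∸_; _^_; _≤_; _<_; ⌊_/2⌋; _%_)
open import Data.Bool using (Bool; true; false; _xor_)
open import Data.List using (List; map; upTo)
open import Data.Product using (_×_)
open import Relation.Binary.PropositionalEquality using (_≡_; _≢_)
open import Relation.Nullary using (¬_)

-- parity of the number of 1's in the binary expansion of n, computed with fuel
-- (fuel ≥ n suffices since ⌊ n /2⌋ < n for n > 0)
popParity : ℕ → ℕ → Bool
popParity zero n = false
popParity (suc f) zero = false
popParity (suc f) (suc n) = lowBit (suc n) xor popParity f ⌊ suc n /2⌋
  where
  lowBit : ℕ → Bool
  lowBit k with k % 2
  ... | zero = false
  ... | suc _ = true

-- Thue–Morse word, 1-indexed as in the paper: t i = parity of popcount of (i - 1), for i ≥ 1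
t : ℕ → Bool
t i = popParity (i ∸ 1) (i ∸ 1)

-- the r-th block (r = 0,1,...) of length m of the j-fix of t:
-- letters t_{j + r m + 1} ... t_{j + r m + m}
block : ℕ → ℕ → ℕ → List Bool
block j m r = map (λ i → t (j + r * m + suc i)) (upTo m)

IsAntiPower : ℕ → ℕ → ℕ → Set
IsAntiPower j m k = ∀ r s → r < k → s < k → r ≢ s → block j m r ≢ block j m s

-- K is the value 𝔎_j(m): the smallest positive k such that the j-fix of length k m
-- is not a k-anti-power
IsK : ℕ → ℕ → ℕ → Set
IsK j m K = (1 ≤ K) × ¬ IsAntiPower j m K × (∀ k → 1 ≤ k → k < K → IsAntiPower j m k)

module Submission where

-- Let tm be the Thue–Morse word indexed from 0.  Binary expansions concatenate, so
-- tm (2^a X + y) = tm X xor tm y for y < 2^a (tm-concat).  Consequently, if m is a period of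
-- tm on c consecutive positions E, …, E + c - 1, then 2^ℓ m is a period of tm on the scaled
-- window [2^ℓ E, 2^ℓ (E + c)) (scaled-window).  A block of the j-fix lying in that window
-- equals the block 2^ℓ positions later, so the j-fix stops being an anti-power; choosing the
-- block just after 2^ℓ E gives the general estimate 𝔎_j(m)·m + j ≤ 2^ℓ (E + c + m) whenever
-- j + 2m ≤ 2^ℓ c (period-bound).
--
-- For m = 2^(a+1)(2g + 1) + 1 and 1 ≤ n ≤ 2^a, the hypothesis t_{m-n} = t_{m-n+1} yields such
-- a period on c = 2 positions E, E + 1 with E + 2n + 1 = m (theorem13-period), the size
-- hypothesis yields m + j ≤ 2^ℓ, and the stated bound follows by arithmetic.

open import Defs
open import Data.Nat using (ℕ; zero; suc; _+_; _*_; _∸_; _^_; _≤_; _<_; _%_)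
open import Data.Nat.Logarithm using (⌈log₂_⌉)
open import Data.Product using (_×_; ∃-syntax)
open import Relation.Binary.PropositionalEquality using (_≡_)

open import Data.Nat using (z≤n; s≤s; _≟_; _<?_; ⌊_/2⌋; NonZero; >-nonZero)
open import Data.Nat.Properties
open import Data.Nat.DivMod using (_/_; m≡m%n+[m/n]*n; m%n<n; m/n*n≤m; m*n%n≡0; [m+kn]%n≡m%n)
open import Data.Nat.Induction using (<-wellFounded)
open import Data.Nat.Tactic.RingSolver using (solve-∀)
open import Data.Bool using (Bool; true; false; not; _xor_)
import Data.Bool.Properties as Bool
import Data.List.Properties as List
open import Data.List.Relation.Unary.All using (tabulate)
open import Data.List.Membership.Propositional.Properties using (∈-upTo⁻)
open import Data.Product using (∃; _,_)
open import Data.Sum using (_⊎_; inj₁; inj₂)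
open import Relation.Binary.PropositionalEquality
  using (_≢_; refl; sym; trans; cong; cong₂; subst; subst₂; module ≡-Reasoning)
open import Relation.Nullary using (Dec; yes; no; ¬_; ¬?; contradiction)
open import Relation.Nullary.Decidable using (map′; _→-dec_; decidable-stable)
open import Relation.Unary using (Pred; Decidable)
open import Induction.WellFounded using (Acc; acc)

tm : ℕ → Bool
tm x = t (suc x)

-- The low binary digit of k, defined exactly as the local helper of popParity in Defs.
oddBit : ℕ → Bool
oddBit k with k % 2
... | zero  = false
... | suc _ = true

popParity-suc : ∀ f n → popParity (suc f) (suc n) ≡ oddBit (suc n) xor popParity f ⌊ suc n /2⌋
popParity-suc f n with suc n % 2
... | zero  = refl
... | suc _ = refl

-- Halving strictly decreases positive numbers, so the fuel of popParity never runs out.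
⌊suc-n/2⌋≤n : ∀ n → ⌊ suc n /2⌋ ≤ n
⌊suc-n/2⌋≤n n = ≤-pred (⌊n/2⌋<n n)

popParity-fuel : ∀ {f g} n → n ≤ f → n ≤ g → popParity f n ≡ popParity g n
popParity-fuel {f} {g} zero _ _ = trans (at-zero f) (sym (at-zero g))
  where
  at-zero : ∀ f → popParity f 0 ≡ false
  at-zero zero    = refl
  at-zero (suc f) = refl
popParity-fuel {suc f} {suc g} (suc n) (s≤s n≤f) (s≤s n≤g) = begin
  popParity (suc f) (suc n)           ≡⟨ popParity-suc f n ⟩
  oddBit (suc n) xor popParity f half  ≡⟨ cong (oddBit (suc n) xor_) (popParity-fuel half half≤f half≤g) ⟩
  oddBit (suc n) xor popParity g half  ≡⟨ popParity-suc g n ⟨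
  popParity (suc g) (suc n)           ∎
  where
  open ≡-Reasoning
  half : ℕ
  half = ⌊ suc n /2⌋
  half≤f : half ≤ f
  half≤f = ≤-trans (⌊suc-n/2⌋≤n n) n≤f
  half≤g : half ≤ g
  half≤g = ≤-trans (⌊suc-n/2⌋≤n n) n≤g

tm-suc : ∀ n → tm (suc n) ≡ oddBit (suc n) xor tm ⌊ suc n /2⌋
tm-suc n = trans (popParity-suc n n)
  (cong (oddBit (suc n) xor_) (popParity-fuel _ (⌊suc-n/2⌋≤n n) ≤-refl))

⌊2n/2⌋≡n : ∀ n → ⌊ 2 * n /2⌋ ≡ n
⌊2n/2⌋≡n zero = refl
⌊2n/2⌋≡n (suc n) = trans (cong ⌊_/2⌋ (*-suc 2 n)) (cong suc (⌊2n/2⌋≡n n))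

⌊1+2n/2⌋≡n : ∀ n → ⌊ suc (2 * n) /2⌋ ≡ n
⌊1+2n/2⌋≡n zero = refl
⌊1+2n/2⌋≡n (suc n) =
  trans (cong (λ k → ⌊ suc k /2⌋) (*-suc 2 n)) (cong suc (⌊1+2n/2⌋≡n n))

oddBit-even : ∀ n → oddBit (2 * n) ≡ false
oddBit-even n with (2 * n) % 2 | trans (cong (_% 2) (*-comm 2 n)) (m*n%n≡0 n 2)
... | zero  | _  = refl
... | suc _ | ()

oddBit-odd : ∀ n → oddBit (suc (2 * n)) ≡ true
oddBit-odd n with suc (2 * n) % 2 | trans (cong (λ k → suc k % 2) (*-comm 2 n)) ([m+kn]%n≡m%n 1 n 2)
... | zero  | ()
... | suc _ | _  = refl

tm-double : ∀ n → tm (2 * n) ≡ tm n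
tm-double zero = refl
tm-double (suc n) = begin
  tm (2 * suc n)                                   ≡⟨ cong tm (*-suc 2 n) ⟩
  tm (suc (suc (2 * n)))                           ≡⟨ tm-suc (suc (2 * n)) ⟩
  oddBit (2 + 2 * n) xor tm ⌊ 2 + 2 * n /2⌋        ≡⟨ cong₂ _xor_ low-digit (cong (λ k → tm (suc k)) (⌊2n/2⌋≡n n)) ⟩
  tm (suc n)                                       ∎
  where
  open ≡-Reasoning
  low-digit : oddBit (2 + 2 * n) ≡ false
  low-digit = trans (cong oddBit (sym (*-suc 2 n))) (oddBit-even (suc n))

tm-double+1 : ∀ n → tm (suc (2 * n)) ≡ not (tm n)
tm-double+1 n = trans (tm-suc (2 * n)) (cong₂ _xor_ (oddBit-odd n) (cong tm (⌊1+2n/2⌋≡n n)))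

even-or-odd : ∀ y → ∃ λ q → y ≡ 2 * q ⊎ y ≡ suc (2 * q)
even-or-odd zero = 0 , inj₁ refl
even-or-odd (suc y) with even-or-odd y
... | q , inj₁ y≡2q   = q , inj₂ (cong suc y≡2q)
... | q , inj₂ y≡2q+1 = suc q , inj₁ (trans (cong suc y≡2q+1) (sym (*-suc 2 q)))

-- Concatenation of binary expansions: if y has at most a binary digits, the digits of
-- 2^a·X + y are those of X followed by those of y, so the digit-sum parities add.
tm-concat : ∀ a X y → y < 2 ^ a → tm (2 ^ a * X + y) ≡ tm X xor tm y
tm-concat zero X zero _ =
  trans (cong tm (trans (+-identityʳ (1 * X)) (*-identityˡ X))) (sym (Bool.xor-identityʳ (tm X)))
tm-concat zero X (suc y) (s≤s ())
tm-concat (suc a) X y y<2B with even-or-odd y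
... | q , inj₁ refl = begin
  tm (2 ^ suc a * X + 2 * q)   ≡⟨ cong tm (shift-even (2 ^ a) X q) ⟩
  tm (2 * (2 ^ a * X + q))     ≡⟨ tm-double (2 ^ a * X + q) ⟩
  tm (2 ^ a * X + q)           ≡⟨ tm-concat a X q (*-cancelˡ-< 2 q (2 ^ a) y<2B) ⟩
  tm X xor tm q                ≡⟨ cong (tm X xor_) (tm-double q) ⟨
  tm X xor tm (2 * q)          ∎
  where open ≡-Reasoning
        shift-even : ∀ B X q → 2 * B * X + 2 * q ≡ 2 * (B * X + q)
        shift-even = solve-∀
... | q , inj₂ refl = begin
  tm (2 ^ suc a * X + suc (2 * q))   ≡⟨ cong tm (shift-odd (2 ^ a) X q) ⟩
  tm (suc (2 * (2 ^ a * X + q)))     ≡⟨ tm-double+1 (2 ^ a * X + q) ⟩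
  not (tm (2 ^ a * X + q))           ≡⟨ cong not (tm-concat a X q (*-cancelˡ-< 2 q (2 ^ a) (<-trans (n<1+n _) y<2B))) ⟩
  not (tm X xor tm q)                ≡⟨ Bool.not-distribʳ-xor (tm X) (tm q) ⟩
  tm X xor not (tm q)                ≡⟨ cong (tm X xor_) (tm-double+1 q) ⟨
  tm X xor tm (suc (2 * q))          ∎
  where open ≡-Reasoning
        shift-odd : ∀ B X q → 2 * B * X + suc (2 * q) ≡ suc (2 * (B * X + q))
        shift-odd = solve-∀

PeriodOn : ℕ → ℕ → ℕ → Set
PeriodOn m E c = ∀ i → i < c → tm (E + i + m) ≡ tm (E + i)

scaled-period : ∀ ℓ m X → tm (X + m) ≡ tm X →
  ∀ y → y < 2 ^ ℓ → tm (2 ^ ℓ * X + y) ≡ tm (2 ^ ℓ * X + y + 2 ^ ℓ * m)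
scaled-period ℓ m X period y y<Q = begin
  tm (Q * X + y)             ≡⟨ tm-concat ℓ X y y<Q ⟩
  tm X xor tm y              ≡⟨ cong (_xor tm y) period ⟨
  tm (X + m) xor tm y        ≡⟨ tm-concat ℓ (X + m) y y<Q ⟨
  tm (Q * (X + m) + y)       ≡⟨ cong tm (regroup Q X m y) ⟩
  tm (Q * X + y + Q * m)     ∎
  where
  open ≡-Reasoning
  Q : ℕ
  Q = 2 ^ ℓ
  regroup : ∀ Q X m y → Q * (X + m) + y ≡ Q * X + y + Q * m
  regroup = solve-∀

scaled-window : ∀ ℓ m E c → PeriodOn m E c →
  ∀ z → 2 ^ ℓ * E ≤ z → z < 2 ^ ℓ * (E + c) → tm z ≡ tm (z + 2 ^ ℓ * m)
scaled-window ℓ m E zero _ z lo hi =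
  contradiction lo (<⇒≱ (subst (z <_) (cong (2 ^ ℓ *_) (+-identityʳ E)) hi))
scaled-window ℓ m E (suc c) period z lo hi with z <? 2 ^ ℓ * (E + c)
... | yes z<end = scaled-window ℓ m E c (λ i i<c → period i (m<n⇒m<1+n i<c)) z lo z<end
... | no z≮end = subst (λ w → tm w ≡ tm (w + 2 ^ ℓ * m)) z≡
      (scaled-period ℓ m (E + c) (period c (n<1+n c)) y y<Q)
  where
  start : ℕ
  start = 2 ^ ℓ * (E + c)
  y : ℕ
  y = z ∸ start
  z≡ : start + y ≡ z
  z≡ = m+[n∸m]≡n (≮⇒≥ z≮end)
  last-interval : ∀ Q E c → Q * (E + suc c) ≡ Q * (E + c) + Q
  last-interval = solve-∀
  y<Q : y < 2 ^ ℓ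
  y<Q = +-cancelˡ-< start y (2 ^ ℓ)
          (subst₂ _<_ (sym z≡) (last-interval (2 ^ ℓ) E c) hi)

block-shift : ∀ j m r ℓ E c → PeriodOn m E c →
  2 ^ ℓ * E ≤ j + r * m → j + r * m + m ≤ 2 ^ ℓ * (E + c) →
  block j m r ≡ block j m (r + 2 ^ ℓ)
block-shift j m r ℓ E c period lo hi =
  List.map-cong-local (tabulate (λ i∈ → same-letter _ (∈-upTo⁻ i∈)))
  where
  same-letter : ∀ i → i < m → t (j + r * m + suc i) ≡ t (j + (r + 2 ^ ℓ) * m + suc i)
  same-letter i i<m = begin
    t (j + r * m + suc i)            ≡⟨ cong t (+-suc (j + r * m) i) ⟩
    tm (j + r * m + i)               ≡⟨ scaled-window ℓ m E c period (j + r * m + i)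
                                          (≤-trans lo (m≤m+n _ i)) (<-≤-trans (+-monoʳ-< (j + r * m) i<m) hi) ⟩
    tm (j + r * m + i + 2 ^ ℓ * m)   ≡⟨ cong tm (shift j r m (2 ^ ℓ) i) ⟩
    tm (j + (r + 2 ^ ℓ) * m + i)     ≡⟨ cong t (+-suc (j + (r + 2 ^ ℓ) * m) i) ⟨
    t (j + (r + 2 ^ ℓ) * m + suc i)  ∎
    where
    open ≡-Reasoning
    shift : ∀ j r m Q i → j + r * m + i + Q * m ≡ j + (r + Q) * m + i
    shift = solve-∀

module _ {p} {P : Pred ℕ p} (P? : Decidable P) where

  least-failure : ∀ N → ¬ P N → ∃ λ K → K ≤ N × ¬ P K × (∀ k → k < K → P k)
  least-failure N = go N (<-wellFounded N)
    where
    go : ∀ N → Acc _<_ N → ¬ P N → ∃ λ K → K ≤ N × ¬ P K × (∀ k → k < K → P k)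
    go N (acc smaller) ¬PN with anyUpTo? (λ k → ¬? (P? k)) N
    ... | no none = N , ≤-refl , ¬PN ,
          λ k k<N → decidable-stable (P? k) (λ ¬Pk → none (k , k<N , ¬Pk))
    ... | yes (n , n<N , ¬Pn) with go n (smaller n<N) ¬Pn
    ...   | K , K≤n , ¬PK , below = K , ≤-trans K≤n (<⇒≤ n<N) , ¬PK , below

antiPower? : ∀ j m k → Dec (IsAntiPower j m k)
antiPower? j m k =
  map′ (λ all r s r<k s<k → all r<k s<k) (λ ap {r} r<k {s} s<k → ap r s r<k s<k)
    (allUpTo? (λ r → allUpTo? (λ s → distinct? r s) k) k)
  where
  distinct? : ∀ r s → Dec (r ≢ s → block j m r ≢ block j m s)
  distinct? r s = ¬? (r ≟ s) →-dec ¬? (List.≡-dec Bool._≟_ (block j m r) (block j m s))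

K-of-repeat : ∀ j m r s → r < s → block j m r ≡ block j m s →
  ∃ λ K → IsK j m K × K ≤ suc s
K-of-repeat j m r s r<s same with least-failure (antiPower? j m) (suc s)
                                    (λ ap → ap r s (m<n⇒m<1+n r<s) ≤-refl (<⇒≢ r<s) same)
... | zero  , _   , ¬AP0 , _     = contradiction (λ r s ()) ¬AP0
... | suc K , K≤s , ¬APK , below = suc K , (s≤s z≤n , ¬APK , λ k _ k<K → below k k<K) , K≤s

multiple-above : ∀ x m → 0 < m → ∃ λ r → x ≤ r * m × r * m ≤ x + m
multiple-above x m 0<m = suc q , <⇒≤ x<[1+q]m , [1+q]m≤x+m
  where
  instance
    m≢0 : NonZero m
    m≢0 = >-nonZero 0<m
  q : ℕ
  q = x / m
  x<[1+q]m : x < m + q * m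
  x<[1+q]m = subst (_< m + q * m) (sym (m≡m%n+[m/n]*n x m)) (+-monoˡ-< (q * m) (m%n<n x m))
  [1+q]m≤x+m : m + q * m ≤ x + m
  [1+q]m≤x+m = subst (m + q * m ≤_) (+-comm m x) (+-monoʳ-≤ m (m/n*n≤m x m))

block-fits : ∀ j m r Q E c → r * m ≤ Q * E + m → j + 2 * m ≤ Q * c →
  j + r * m + m ≤ Q * (E + c)
block-fits j m r Q E c rm≤QE+m room = begin
  j + r * m + m         ≤⟨ +-monoˡ-≤ m (+-monoʳ-≤ j rm≤QE+m) ⟩
  j + (Q * E + m) + m   ≡⟨ regroup j Q E m ⟩
  Q * E + (j + 2 * m)   ≤⟨ +-monoʳ-≤ (Q * E) room ⟩
  Q * E + Q * c         ≡⟨ *-distribˡ-+ Q E c ⟨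
  Q * (E + c)           ∎
  where
  open ≤-Reasoning
  regroup : ∀ j Q E m → j + (Q * E + m) + m ≡ Q * E + (j + 2 * m)
  regroup = solve-∀

-- Core estimate: if m is a period of tm on c consecutive positions starting at E and the
-- scaled window has room for a block (j + 2m ≤ 2^ℓ c), then some block of the j-fix repeats
-- 2^ℓ blocks later, whence 𝔎_j(m)·m + j ≤ 2^ℓ (E + c + m).
period-bound : ∀ j m ℓ E c → 0 < m → PeriodOn m E c → j + 2 * m ≤ 2 ^ ℓ * c →
  ∃ λ K → IsK j m K × K * m + j ≤ 2 ^ ℓ * (E + c + m)
period-bound j m ℓ E c 0<m period room with multiple-above (2 ^ ℓ * E) m 0<m
... | r , QE≤rm , rm≤QE+m with K-of-repeat j m r (r + 2 ^ ℓ) (m<m+n r (m^n>0 2 ℓ))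
      (block-shift j m r ℓ E c period (≤-trans QE≤rm (m≤n+m _ j))
        (block-fits j m r (2 ^ ℓ) E c rm≤QE+m room))
...   | K , isK , K≤ = K , isK , (begin
  K * m + j                  ≤⟨ +-monoˡ-≤ j (*-monoˡ-≤ m K≤) ⟩
  suc (r + Q) * m + j        ≡⟨ regroup r Q m j ⟩
  (j + r * m + m) + Q * m    ≤⟨ +-monoˡ-≤ (Q * m) (block-fits j m r Q E c rm≤QE+m room) ⟩
  Q * (E + c) + Q * m        ≡⟨ *-distribˡ-+ Q (E + c) m ⟨
  Q * (E + c + m)            ∎)
  where
  open ≤-Reasoning
  Q : ℕ
  Q = 2 ^ ℓ
  regroup : ∀ r Q m j → suc (r + Q) * m + j ≡ (j + r * m + m) + Q * m
  regroup = solve-∀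

-- If 2e + m = 2M + 1, tm (2e) = not (tm M) and
-- tm M = tm (M + 1), then m is a period of tm on {2e, 2e + 1}: doubling M (resp. M + 1)
-- and appending a binary digit relates both sides.
period-from-pair : ∀ m M e → 2 * e + m ≡ suc (2 * M) → tm (2 * e) ≡ not (tm M) →
  tm M ≡ tm (suc M) → PeriodOn m (2 * e) 2
period-from-pair m M e shift flip pair zero _ = begin
  tm (2 * e + 0 + m)    ≡⟨ cong (λ x → tm (x + m)) (+-identityʳ (2 * e)) ⟩
  tm (2 * e + m)        ≡⟨ cong tm shift ⟩
  tm (suc (2 * M))      ≡⟨ tm-double+1 M ⟩
  not (tm M)            ≡⟨ flip ⟨
  tm (2 * e)            ≡⟨ cong tm (+-identityʳ (2 * e)) ⟨
  tm (2 * e + 0)        ∎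
  where open ≡-Reasoning
period-from-pair m M e shift flip pair (suc zero) _ = begin
  tm (2 * e + 1 + m)    ≡⟨ cong tm (trans (+-assoc (2 * e) 1 m) (trans (+-suc (2 * e) m) (cong suc shift))) ⟩
  tm (suc (suc (2 * M))) ≡⟨ cong tm (*-suc 2 M) ⟨
  tm (2 * suc M)        ≡⟨ tm-double (suc M) ⟩
  tm (suc M)            ≡⟨ pair ⟨
  tm M                  ≡⟨ Bool.not-involutive (tm M) ⟨
  not (not (tm M))      ≡⟨ cong not flip ⟨
  not (tm (2 * e))      ≡⟨ cong not (tm-double e) ⟩
  not (tm e)            ≡⟨ tm-double+1 e ⟨
  tm (suc (2 * e))      ≡⟨ cong tm (+-comm (2 * e) 1) ⟨
  tm (2 * e + 1)        ∎
  where open ≡-Reasoning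
period-from-pair m M e shift flip pair (suc (suc i)) (s≤s (s≤s ()))

-- Binary layout for B = 2^a and u < B: the letter at 2(2B g + u) is the complement of the
-- letter at 4B g + B + u, since the leading block of B + u contributes a single 1.
binary-layout : ∀ a g u → u < 2 ^ a →
  tm (2 * (2 ^ suc a * g + u)) ≡ not (tm (2 ^ suc (suc a) * g + (2 ^ a + u)))
binary-layout a g u u<B = begin
  tm (2 * (2 ^ suc a * g + u))                ≡⟨ tm-double (2 ^ suc a * g + u) ⟩
  tm (2 ^ suc a * g + u)                      ≡⟨ tm-concat (suc a) g u (m<n⇒m<o*n 2 u<B) ⟩
  tm g xor tm u                               ≡⟨ cong (tm g xor_) (Bool.not-involutive (tm u)) ⟨
  tm g xor not (not (tm u))                   ≡⟨ Bool.not-distribʳ-xor (tm g) (not (tm u)) ⟨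
  not (tm g xor not (tm u))                   ≡⟨ cong (λ b → not (tm g xor b)) high-bit ⟨
  not (tm g xor tm (2 ^ a + u))               ≡⟨ cong not (tm-concat (suc (suc a)) g (2 ^ a + u) B+u<4B) ⟨
  not (tm (2 ^ suc (suc a) * g + (2 ^ a + u))) ∎
  where
  open ≡-Reasoning
  high-bit : tm (2 ^ a + u) ≡ not (tm u)
  high-bit = trans (cong (λ x → tm (x + u)) (sym (*-identityʳ (2 ^ a)))) (tm-concat a 1 u u<B)
  B+u<4B : 2 ^ a + u < 2 ^ suc (suc a)
  B+u<4B = <-≤-trans (+-monoʳ-< (2 ^ a) u<B)
             (subst (2 ^ a + 2 ^ a ≤_) (four (2 ^ a)) (m≤m+n (2 ^ a + 2 ^ a) (2 ^ a + 2 ^ a)))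
    where
    four : ∀ B → B + B + (B + B) ≡ 2 * (2 * B)
    four = solve-∀

odd-split : ∀ h → h % 2 ≡ 1 → ∃ λ g → h ≡ suc (2 * g)
odd-split h h-odd = h / 2 ,
  trans (m≡m%n+[m/n]*n h 2) (trans (cong (_+ h / 2 * 2) h-odd) (cong suc (*-comm (h / 2) 2)))

-- The positions of Theorem 13 for B = 2^a, m = 2B(2g + 1) + 1 and n + u = B:
-- M = 4Bg + B + u is the 0-based position of t_{m-n}, and E = 2(2Bg + u) ends 2n + 1
-- letters before m.
layout-arith : ∀ B n u g → n + u ≡ B →
  let m = 2 * B * suc (2 * g) + 1
      M = 2 * (2 * B) * g + (B + u)
      e = 2 * B * g + u
  in m ≡ suc M + n × 2 * e + m ≡ suc (2 * M) × suc (2 * e + 2 * n) ≡ m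
layout-arith _ n u g refl = start n u g , shift n u g , end n u g
  where
  start : ∀ n u g → 2 * (n + u) * suc (2 * g) + 1 ≡ suc (2 * (2 * (n + u)) * g + ((n + u) + u)) + n
  start = solve-∀
  shift : ∀ n u g → 2 * (2 * (n + u) * g + u) + (2 * (n + u) * suc (2 * g) + 1)
                    ≡ suc (2 * (2 * (2 * (n + u)) * g + ((n + u) + u)))
  shift = solve-∀
  end : ∀ n u g → suc (2 * (2 * (n + u) * g + u) + 2 * n) ≡ 2 * (n + u) * suc (2 * g) + 1
  end = solve-∀

theorem13-period : ∀ a h n → h % 2 ≡ 1 → 1 ≤ n → n ≤ 2 ^ a →
  let m = 2 ^ suc a * h + 1
  in t (m ∸ n) ≡ t (m ∸ n + 1) → ∃ λ E → PeriodOn m E 2 × suc (E + 2 * n) ≡ m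
theorem13-period a h n h-odd 1≤n n≤B t-eq with odd-split h h-odd | m≤n⇒∃[o]m+o≡n n≤B
... | g , refl | u , n+u≡B with layout-arith (2 ^ a) n u g n+u≡B
...   | m≡M+n , shift , end =
  2 * e , period-from-pair m M e shift (binary-layout a g u u<B) pair , end
  where
  m M e : ℕ
  m = 2 ^ suc a * suc (2 * g) + 1
  M = 2 ^ suc (suc a) * g + (2 ^ a + u)
  e = 2 ^ suc a * g + u
  u<B : u < 2 ^ a
  u<B = subst (u <_) (trans (+-comm u n) n+u≡B) (m<m+n u 1≤n)
  m∸n≡1+M : m ∸ n ≡ suc M
  m∸n≡1+M = trans (cong (_∸ n) m≡M+n) (m+n∸n≡m (suc M) n)
  pair : tm M ≡ tm (suc M)
  pair = trans (subst (λ x → t x ≡ t (x + 1)) m∸n≡1+M t-eq) (cong tm (+-comm M 1))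

-- The size hypothesis of Theorem 13 is only used through its consequence m + j ≤ 2^ℓ.
size-bound : ∀ x y n → x * (2 * n + 2) ≤ (2 * n + 1) * y → x ≤ y
size-bound x y n le = *-cancelʳ-≤ x y (suc (2 * n)) (begin
  x * suc (2 * n)     ≤⟨ *-monoʳ-≤ x (subst (suc (2 * n) ≤_) (+-comm 2 (2 * n)) (n≤1+n _)) ⟩
  x * (2 * n + 2)     ≤⟨ le ⟩
  (2 * n + 1) * y     ≡⟨ swap n y ⟩
  y * suc (2 * n)     ∎)
  where
  open ≤-Reasoning
  swap : ∀ n y → (2 * n + 1) * y ≡ y * suc (2 * n)
  swap = solve-∀

two-cell-room : ∀ m j Q → m + j ≤ Q → j + 2 * m ≤ Q * 2
two-cell-room m j Q m+j≤Q = begin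
  j + 2 * m             ≡⟨ regroup m j ⟩
  (m + j) + m           ≤⟨ +-mono-≤ m+j≤Q (≤-trans (m≤m+n m j) m+j≤Q) ⟩
  Q + Q                 ≡⟨ double Q ⟩
  Q * 2                 ∎
  where
  open ≤-Reasoning
  regroup : ∀ m j → j + 2 * m ≡ (m + j) + m
  regroup = solve-∀
  double : ∀ Q → Q + Q ≡ Q * 2
  double = solve-∀

theorem13-arith : ∀ ℓ K m j E n → 1 ≤ n →
  K * m + j ≤ 2 ^ ℓ * (E + 2 + m) → suc (E + 2 * n) ≡ m →
  K * m + (2 ^ (ℓ + 1) * (n ∸ 1) + j) ≤ 2 ^ (ℓ + 1) * m
theorem13-arith ℓ K m j E (suc n) _ bound end rewrite ^-distribˡ-+-* 2 ℓ 1 = begin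
  K * m + (Q * 2 * n + j)       ≡⟨ regroup (K * m) Q n j ⟩
  (K * m + j) + Q * 2 * n       ≤⟨ +-monoˡ-≤ (Q * 2 * n) bound ⟩
  Q * (E + 2 + m) + Q * 2 * n   ≡⟨ collect Q E m n ⟩
  Q * (E + 2 * suc n + m)       ≤⟨ *-monoʳ-≤ Q (+-monoˡ-≤ m (subst (E + 2 * suc n ≤_) end (n≤1+n _))) ⟩
  Q * (m + m)                   ≡⟨ double Q m ⟩
  Q * 2 * m                     ∎
  where
  open ≤-Reasoning
  Q : ℕ
  Q = 2 ^ ℓ
  regroup : ∀ x Q n j → x + (Q * 2 * n + j) ≡ (x + j) + Q * 2 * n
  regroup = solve-∀
  collect : ∀ Q E m n → Q * (E + 2 + m) + Q * 2 * n ≡ Q * (E + 2 * suc n + m)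
  collect = solve-∀
  double : ∀ Q m → Q * (m + m) ≡ Q * 2 * m
  double = solve-∀

mainTheorem13 : (j L h n : ℕ) → 3 ≤ L → h % 2 ≡ 1 →
    let m = 2 ^ L * h + 1
        ℓ = ⌈log₂ (m + j) ⌉
    in 2 ≤ n → n ≤ 2 ^ (L ∸ 1) → t (m ∸ n) ≡ t (m ∸ n + 1) →
       (m + j) * (2 * n + 2) ≤ (2 * n + 1) * 2 ^ ℓ →
       ∃[ K ] (IsK j m K × (K * m + (2 ^ (ℓ + 1) * (n ∸ 1) + j) ≤ 2 ^ (ℓ + 1) * m))
mainTheorem13 j (suc a) h n _ h-odd 2≤n n≤B t-eq size =
  let E , period , end = theorem13-period a h n h-odd 1≤n n≤B t-eq
      K , isK , bound  = period-bound j m ℓ E 2 (m≤n+m 1 (2 ^ suc a * h)) period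
                           (two-cell-room m j (2 ^ ℓ) (size-bound (m + j) (2 ^ ℓ) n size))
  in K , isK , theorem13-arith ℓ K m j E n 1≤n bound end
  where
  m : ℕ
  m = 2 ^ suc a * h + 1
  ℓ : ℕ
  ℓ = ⌈log₂ (m + j) ⌉
  1≤n : 1 ≤ n
  1≤n = ≤-trans (s≤s z≤n) 2≤n
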